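{- Let $G=(L,R,E)$ be a finite bipartite graph and run Algorithm PivotBiCluster on $G$, coloring pairs as described in the context. Then in every execution, each pair $(\ell,r)\in L\times R$ is colored at most once, and each erroneous pair of the output clustering is colored exactly once.
   Context: Input: bipartite graph $G=(L,R,E)$, $E\subseteq L\times R$. For a clustering of $L\cup R$, a pair $(\ell,r)\in L\times R$ is erroneous if either $(\ell,r)\in E$ but $\ell,r$ are in different clusters, or $(\ell,r)\notin E$ but $\ell,r$ are in the same cluster. Algorithm PivotBiCluster: $N(\ell)$ denotes the set of right nodes adjacent to $\ell\in L$ not yet removed. While left nodes remain: choose a remaining left node $\ell_1$ uniformly at random (the "left center") and form $C=\{\ell_1\}\cup N(\ell_1)$. For each other remaining left node $\ell_2$, with neighborhoods at the moment $\ell_1$ was chosen, let $R_1=N(\ell_1)\setminus N(\ell_2)$, $R_{1,2}=N(\ell_1)\cap N(\ell_2)$, $R_2=N(\ell_2)\setminus N(\ell_1)$; with probability $\min\{|R_{1,2}|/|R_2|,1\}$ (taken as $1$ if $|R_2|=0$): if $|R_{1,2}|\ge|R_1|$ append $\ell_2$ to $C$, else make $\ell_2$ a singleton; otherwise do nothing with $\ell_2$. Remove $C$ and the new singletons and repeat. A tuple is $T=(\ell_1^T,\ell_2^T,R_1^T,R_{1,2}^T,R_2^T)$ with $\ell_1^T\neq\ell_2^T\in L$, and (with $N$ the neighborhood in $G$) $R_1^T\subseteq N(\ell_1^T)\setminus N(\ell_2^T)$, $R_2^T\subseteq N(\ell_2^T)\setminus N(\ell_1^T)$, $R_{1,2}^T\subseteq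 N(\ell_1^T)\cap N(\ell_2^T)$. The bad event $X_T$ happens if during the execution $\ell_1^T$ is chosen as left center while $\ell_2^T$ is still in the graph and at that moment the current neighborhoods satisfy $R_1^T=N(\ell_1^T)\setminus N(\ell_2^T)$, $R_{1,2}^T=N(\ell_1^T)\cap N(\ell_2^T)$, $R_2^T=N(\ell_2^T)\setminus N(\ell_1^T)$. Coloring: if $X_T$ happens, color with color $T$ all pairs $(\ell_2^T,r)$ with $r\in R_1^T$, all pairs $(\ell_2^T,r)$ with $r\in R_{1,2}^T$, and also all pairs $(\ell_2^T,r)$ with $r\in R_2^T$ but only if, in the processing of $\ell_2^T$ during this phase, $\ell_2^T$ was appended to $\ell_1^T$'s cluster or made a singleton. -}

module Defs where

open import Data.Nat using (ℕ; zero; suc; _<_; _≤ᵇ_)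
open import Data.Bool using (Bool; true; false; _∧_; not; if_then_else_)
open import Data.Fin using (Fin; _≟_)
open import Data.Fin.Subset using (Subset; _∈_; _∉_; _⊆_; _∩_; ∁; ∣_∣)
open import Data.Vec using (lookup; tabulate)
open import Data.Product using (_×_)
open import Data.Sum using (_⊎_)
open import Data.Empty using (⊥)
open import Relation.Binary.PropositionalEquality using (_≡_; _≢_)
open import Relation.Nullary using (does)

_∖_ : ∀ {k} → Subset k → Subset k → Subset k
p ∖ q = p ∩ ∁ q

-- Bipartite graph G = (L, R, E) with L = Fin m, R = Fin n and
-- (ℓ , r) ∈ E  iff  E ℓ r ≡ true.
module PivotBiCluster {m n : ℕ} (E : Fin m → Fin n → Bool) where

  NG : Fin m → Subset n
  NG ℓ = tabulate (E ℓ)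

  -- current neighbourhood of ℓ, given the set remR of right nodes not yet removed
  Nb : Subset n → Fin m → Subset n
  Nb remR ℓ = NG ℓ ∩ remR

  R₁ R₁₂ R₂ : Subset n → Fin m → Fin m → Subset n
  R₁  remR ℓ₁ ℓ₂ = Nb remR ℓ₁ ∖ Nb remR ℓ₂
  R₁₂ remR ℓ₁ ℓ₂ = Nb remR ℓ₁ ∩ Nb remR ℓ₂
  R₂  remR ℓ₁ ℓ₂ = Nb remR ℓ₂ ∖ Nb remR ℓ₁

  eqᵇ : Fin m → Fin m → Bool
  eqᵇ a b = does (a ≟ b)

  -- The random coin for ℓ₂ succeeds with probability min(|R₁₂|/|R₂|, 1)
  -- (= 1 if |R₂| = 0).  An outcome is possible (positive probability) iff:
  CoinOK : Subset n → Fin m → Fin m → Bool → Set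
  CoinOK remR ℓ₁ ℓ₂ true  = 0 < ∣ R₁₂ remR ℓ₁ ℓ₂ ∣ ⊎ ∣ R₂ remR ℓ₁ ℓ₂ ∣ ≡ 0
  CoinOK remR ℓ₁ ℓ₂ false = ∣ R₁₂ remR ℓ₁ ℓ₂ ∣ < ∣ R₂ remR ℓ₁ ℓ₂ ∣

  ValidCoins : Subset m → Subset n → Fin m → (Fin m → Bool) → Set
  ValidCoins remL remR ℓ₁ c = ∀ ℓ₂ → ℓ₂ ∈ remL → ℓ₂ ≢ ℓ₁ → CoinOK remR ℓ₁ ℓ₂ (c ℓ₂)

  processed : Subset m → Fin m → (Fin m → Bool) → Fin m → Bool
  processed remL ℓ₁ c ℓ₂ = lookup remL ℓ₂ ∧ not (eqᵇ ℓ₂ ℓ₁) ∧ c ℓ₂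

  appended : Subset m → Subset n → Fin m → (Fin m → Bool) → Fin m → Bool
  appended remL remR ℓ₁ c ℓ₂ =
    processed remL ℓ₁ c ℓ₂ ∧ (∣ R₁ remR ℓ₁ ℓ₂ ∣ ≤ᵇ ∣ R₁₂ remR ℓ₁ ℓ₂ ∣)

  singled : Subset m → Subset n → Fin m → (Fin m → Bool) → Fin m → Bool
  singled remL remR ℓ₁ c ℓ₂ =
    processed remL ℓ₁ c ℓ₂ ∧ not (∣ R₁ remR ℓ₁ ℓ₂ ∣ ≤ᵇ ∣ R₁₂ remR ℓ₁ ℓ₂ ∣)

  newL : Subset m → Fin m → (Fin m → Bool) → Subset m
  newL remL ℓ₁ c = tabulate λ ℓ →
    lookup remL ℓ ∧ not (eqᵇ ℓ ℓ₁) ∧ not (processed remL ℓ₁ c ℓ)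

  newR : Subset n → Fin m → Subset n
  newR remR ℓ₁ = remR ∖ Nb remR ℓ₁

  -- A (possible) execution of PivotBiCluster from the state (remL, remR):
  -- the sequence of chosen left centers and coin outcomes.
  data Exec (remL : Subset m) (remR : Subset n) : Set where
    done : (∀ ℓ → ℓ ∉ remL) → Exec remL remR
    step : (ℓ₁ : Fin m) → ℓ₁ ∈ remL →
           (c : Fin m → Bool) → ValidCoins remL remR ℓ₁ c →
           Exec (newL remL ℓ₁ c) (newR remR ℓ₁) → Exec remL remR

  -- cluster labels of the output clustering:
  -- clus k = the cluster formed in phase k; singletons otherwise
  -- (right nodes never removed end up as singletons)
  data Label : Set where
    clus  : ℕ → Label
    singL : Fin m → Label
    singR : Fin n → Label

  labelL : ∀ {remL remR} → Exec remL remR → ℕ → Fin m → Label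
  labelL (done _) k ℓ = singL ℓ
  labelL {remL} {remR} (step ℓ₁ _ c _ e) k ℓ =
    if eqᵇ ℓ ℓ₁ then clus k
    else if appended remL remR ℓ₁ c ℓ then clus k
    else if singled remL remR ℓ₁ c ℓ then singL ℓ
    else labelL e (suc k) ℓ

  labelR : ∀ {remL remR} → Exec remL remR → ℕ → Fin n → Label
  labelR (done _) k r = singR r
  labelR {remL} {remR} (step ℓ₁ _ c _ e) k r =
    if lookup (Nb remR ℓ₁) r then clus k else labelR e (suc k) r

  SameCluster : ∀ {remL remR} → Exec remL remR → Fin m → Fin n → Set
  SameCluster e ℓ r = labelL e 0 ℓ ≡ labelR e 0 r

  Erroneous : ∀ {remL remR} → Exec remL remR → Fin m → Fin n → Set
  Erroneous e ℓ r =
    (E ℓ r ≡ true × ¬' (SameCluster e ℓ r)) ⊎ (E ℓ r ≡ false × SameCluster e ℓ r)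
    where ¬' : Set → Set
          ¬' A = A → ⊥

  record Tuple : Set where
    constructor tuple
    field
      ℓ₁ᵀ ℓ₂ᵀ : Fin m
      S₁ S₁₂ S₂ : Subset n
  open Tuple public

  ValidTuple : Tuple → Set
  ValidTuple T =
    ℓ₁ᵀ T ≢ ℓ₂ᵀ T ×
    S₁ T ⊆ (NG (ℓ₁ᵀ T) ∖ NG (ℓ₂ᵀ T)) ×
    S₂ T ⊆ (NG (ℓ₂ᵀ T) ∖ NG (ℓ₁ᵀ T)) ×
    S₁₂ T ⊆ (NG (ℓ₁ᵀ T) ∩ NG (ℓ₂ᵀ T))

  XPhase : Subset m → Subset n → Fin m → Tuple → Set
  XPhase remL remR ℓ₁ T =
    ℓ₁ ≡ ℓ₁ᵀ T × ℓ₂ᵀ T ∈ remL ×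
    R₁ remR ℓ₁ (ℓ₂ᵀ T) ≡ S₁ T × R₁₂ remR ℓ₁ (ℓ₂ᵀ T) ≡ S₁₂ T ×
    R₂ remR ℓ₁ (ℓ₂ᵀ T) ≡ S₂ T

  Happens : ∀ {remL remR} → Exec remL remR → Tuple → Set
  Happens (done _) T = ⊥
  Happens {remL} {remR} (step ℓ₁ _ c _ e) T = XPhase remL remR ℓ₁ T ⊎ Happens e T

  ColoredBy : ∀ {remL remR} → Exec remL remR → Tuple → Fin m → Fin n → Set
  ColoredBy (done _) T ℓ r = ⊥
  ColoredBy {remL} {remR} (step ℓ₁ _ c _ e) T ℓ r =
    (XPhase remL remR ℓ₁ T × ℓ ≡ ℓ₂ᵀ T ×
      (r ∈ S₁ T ⊎ r ∈ S₁₂ T ⊎ (r ∈ S₂ T × processed remL ℓ₁ c (ℓ₂ᵀ T) ≡ true)))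
    ⊎ ColoredBy e T ℓ r

module Submission where

open import Defs
open import Data.Nat using (ℕ; suc; _≤_; _≤ᵇ_)
open import Data.Nat.Properties using (≤-refl; <⇒≤; n≮n)
open import Data.Bool using (Bool; true; false; not; _∧_)
open import Data.Bool.Properties using (∧-conicalˡ; ∧-conicalʳ; not-injective; ¬-not)
  renaming (_≟_ to _≟ᵇ_)
open import Data.Fin using (Fin; _≟_)
open import Data.Fin.Subset using (Subset; ⊤; _∈_; _∉_; _⊆_; _∩_; ∁; ∣_∣)
open import Data.Fin.Subset.Properties
  using (∈⊤; x∈p∩q⁺; x∈p∩q⁻; p∩q⊆p; p∩q⊆q; x∉p⇒x∈∁p; x∈∁p⇒x∉p)
open import Data.Vec using (lookup)
open import Data.Vec.Properties using ([]=⇒lookup; lookup⇒[]=; lookup∘tabulate)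
open import Data.Product using (_×_; Σ; _,_; proj₁; proj₂; map₂) renaming (map to map×)
open import Data.Sum using (_⊎_; inj₁; inj₂)
open import Data.Unit using (tt) renaming (⊤ to Unit)
open import Data.Empty using (⊥; ⊥-elim)
open import Function using (case_of_)
open import Relation.Binary.PropositionalEquality using (_≡_; _≢_; refl; sym; trans; subst; subst₂)
open import Relation.Nullary using (¬_; yes; no)
open import Relation.Nullary.Decidable using (dec-true; dec-false)

-- The execution is an inductive sequence of phases, so both claims are
-- proved by induction along it, generalised to an arbitrary intermediate
-- state (remL, remR) of remaining nodes.
--
-- * At most once.  A colouring in the phase centred at ℓ₁ pins the colour
--   down: it must be the "phase tuple" (ℓ₁, ℓ, R₁, R₁₂, R₂) of the current
--   neighbourhoods.  Moreover, a pair coloured in a phase does not survive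
--   it (r ∈ N(ℓ₁) is removed, or ℓ is processed and removed), whereas a pair
--   coloured in a later phase survives it.  Hence two colourings of a pair
--   happen in the same phase and carry the same colour.
-- * Erroneous pairs are coloured.  Follow a live erroneous pair through a
--   phase centred at ℓ₁ ≠ ℓ: if r ∈ N(ℓ₁), or r ∈ N(ℓ) and ℓ is processed,
--   the pair gets the phase tuple's colour; if ℓ is not processed and
--   r ∉ N(ℓ₁), both labels are decided later and we recurse; in the remaining
--   cases (and when ℓ is the centre) the pair cannot be erroneous, because
--   a right node left over by a phase never receives that phase's cluster
--   nor a left singleton label.

∉⇒lookup≡false : ∀ {k} {p : Subset k} {x} → x ∉ p → lookup p x ≡ false
∉⇒lookup≡false {p = p} {x} x∉p with lookup p x in eq
... | true  = ⊥-elim (x∉p (lookup⇒[]= x p eq))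
... | false = refl

∖-member : ∀ {k} {p q : Subset k} {x} → x ∈ p → x ∉ q → x ∈ p ∖ q
∖-member x∈p x∉q = x∈p∩q⁺ (x∈p , x∉p⇒x∈∁p x∉q)

∖-elim : ∀ {k} {p q : Subset k} {x} → x ∈ p ∖ q → x ∈ p × x ∉ q
∖-elim {p = p} {q} x∈ = map₂ x∈∁p⇒x∉p (x∈p∩q⁻ p (∁ q) x∈)

restrict-∖ : ∀ {k} (p q s : Subset k) → (p ∩ s) ∖ (q ∩ s) ⊆ p ∖ q
restrict-∖ p q s x∈ with ∖-elim {p = p ∩ s} x∈
... | x∈ps , x∉qs with x∈p∩q⁻ p s x∈ps
...   | x∈p , x∈s = ∖-member x∈p (λ x∈q → x∉qs (x∈p∩q⁺ (x∈q , x∈s)))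

restrict-∩ : ∀ {k} (p q s : Subset k) → (p ∩ s) ∩ (q ∩ s) ⊆ p ∩ q
restrict-∩ p q s x∈ with x∈p∩q⁻ (p ∩ s) (q ∩ s) x∈
... | x∈ps , x∈qs = x∈p∩q⁺ (proj₁ (x∈p∩q⁻ p s x∈ps) , proj₁ (x∈p∩q⁻ q s x∈qs))

-- An edge indicator disagrees with a pair of cluster labels; Erroneous is
-- Mismatch of E ℓ r and the labels of ℓ and r.
Mismatch : {A : Set} → Bool → A → A → Set
Mismatch edge a b = (edge ≡ true × a ≢ b) ⊎ (edge ≡ false × a ≡ b)

edge-together : ∀ {A : Set} {edge} {a b : A} → edge ≡ true → a ≡ b → ¬ Mismatch edge a b
edge-together refl a≡b (inj₁ (_ , a≢b)) = a≢b a≡b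
edge-together refl _   (inj₂ (() , _))

non-edge-apart : ∀ {A : Set} {edge} {a b : A} → edge ≡ false → a ≢ b → ¬ Mismatch edge a b
non-edge-apart refl _   (inj₁ (() , _))
non-edge-apart refl a≢b (inj₂ (_ , a≡b)) = a≢b a≡b

module Analysis {m n : ℕ} (E : Fin m → Fin n → Bool) where
  open PivotBiCluster E

  private variable
    remL : Subset m
    remR : Subset n
    a ℓ ℓ₁ : Fin m
    r : Fin n
    c : Fin m → Bool
    k : ℕ

  NG-member : E a r ≡ true → r ∈ NG a
  NG-member {a} {r} edge = lookup⇒[]= r (NG a) (trans (lookup∘tabulate (E a) r) edge)

  NG-edge : r ∈ NG a → E a r ≡ true
  NG-edge {r} {a} r∈ = trans (sym (lookup∘tabulate (E a) r)) ([]=⇒lookup r∈)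

  Nb-member : r ∈ remR → E a r ≡ true → r ∈ Nb remR a
  Nb-member r∈ edge = x∈p∩q⁺ (NG-member edge , r∈)

  Nb-nonmember : E a r ≡ false → r ∉ Nb remR a
  Nb-nonmember {a} {r} {remR} no-edge r∈
    with trans (sym no-edge) (NG-edge (proj₁ (x∈p∩q⁻ (NG a) remR r∈)))
  ... | ()

  lookup-newL : ∀ remL ℓ₁ c ℓ →
    lookup (newL remL ℓ₁ c) ℓ ≡ (lookup remL ℓ ∧ not (eqᵇ ℓ ℓ₁) ∧ not (processed remL ℓ₁ c ℓ))
  lookup-newL remL ℓ₁ c ℓ =
    lookup∘tabulate (λ x → lookup remL x ∧ not (eqᵇ x ℓ₁) ∧ not (processed remL ℓ₁ c x)) ℓ

  newL-member : ℓ ∈ remL → ℓ ≢ ℓ₁ → processed remL ℓ₁ c ℓ ≡ false → ℓ ∈ newL remL ℓ₁ c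
  newL-member {ℓ} {remL} {ℓ₁} {c} ℓ∈ ℓ≢ℓ₁ unprocessed = lookup⇒[]= ℓ (newL remL ℓ₁ c) survives
    where
      survives : lookup (newL remL ℓ₁ c) ℓ ≡ true
      survives rewrite lookup-newL remL ℓ₁ c ℓ | unprocessed
                     | []=⇒lookup ℓ∈ | dec-false (ℓ ≟ ℓ₁) ℓ≢ℓ₁ = refl

  newL-alive : ℓ ∈ newL remL ℓ₁ c → ℓ ∈ remL
  newL-alive {ℓ} {remL} {ℓ₁} {c} ℓ∈ =
    lookup⇒[]= ℓ remL (∧-conicalˡ _ _ (trans (sym (lookup-newL remL ℓ₁ c ℓ)) ([]=⇒lookup ℓ∈)))

  newL-unprocessed : ∀ remL ℓ₁ c → ℓ ∈ newL remL ℓ₁ c → processed remL ℓ₁ c ℓ ≡ false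
  newL-unprocessed {ℓ} remL ℓ₁ c ℓ∈ =
    not-injective (∧-conicalʳ (not (eqᵇ ℓ ℓ₁)) _ (∧-conicalʳ (lookup remL ℓ) _ survives))
    where
      survives : (lookup remL ℓ ∧ not (eqᵇ ℓ ℓ₁) ∧ not (processed remL ℓ₁ c ℓ)) ≡ true
      survives = trans (sym (lookup-newL remL ℓ₁ c ℓ)) ([]=⇒lookup ℓ∈)

  module PhaseLabels (ℓ₁ : Fin m) (p : ℓ₁ ∈ remL) (c : Fin m → Bool) (v : ValidCoins remL remR ℓ₁ c)
                     (e : Exec (newL remL ℓ₁ c) (newR remR ℓ₁)) where

    labelL-centre : labelL (step ℓ₁ p c v e) k ℓ₁ ≡ clus k
    labelL-centre rewrite dec-true (ℓ₁ ≟ ℓ₁) refl = refl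

    labelL-processed : ℓ ≢ ℓ₁ → processed remL ℓ₁ c ℓ ≡ true →
      labelL (step ℓ₁ p c v e) k ℓ ≡ clus k ⊎ labelL (step ℓ₁ p c v e) k ℓ ≡ singL ℓ
    labelL-processed {ℓ} ℓ≢ℓ₁ processed≡true
      rewrite dec-false (ℓ ≟ ℓ₁) ℓ≢ℓ₁ | processed≡true
      with ∣ R₁ remR ℓ₁ ℓ ∣ ≤ᵇ ∣ R₁₂ remR ℓ₁ ℓ ∣
    ... | true  = inj₁ refl
    ... | false = inj₂ refl

    labelL-unprocessed : ℓ ≢ ℓ₁ → processed remL ℓ₁ c ℓ ≡ false →
      labelL (step ℓ₁ p c v e) k ℓ ≡ labelL e (suc k) ℓ
    labelL-unprocessed {ℓ} ℓ≢ℓ₁ unprocessed rewrite dec-false (ℓ ≟ ℓ₁) ℓ≢ℓ₁ | unprocessed = refl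

    labelR-taken : r ∈ Nb remR ℓ₁ → labelR (step ℓ₁ p c v e) k r ≡ clus k
    labelR-taken r∈ rewrite []=⇒lookup r∈ = refl

    labelR-deferred : r ∉ Nb remR ℓ₁ → labelR (step ℓ₁ p c v e) k r ≡ labelR e (suc k) r
    labelR-deferred r∉ rewrite ∉⇒lookup≡false r∉ = refl

  -- The labels a right node can receive from phase j on: a cluster of a
  -- phase ≥ j, or a right singleton, never a left singleton.
  FormedFrom : ℕ → Label → Set
  FormedFrom j (clus i)  = j ≤ i
  FormedFrom j (singL _) = ⊥
  FormedFrom j (singR _) = Unit

  FormedFrom-weaken : ∀ {j} lab → FormedFrom (suc j) lab → FormedFrom j lab
  FormedFrom-weaken (clus i)  = <⇒≤
  FormedFrom-weaken (singR _) = λ _ → tt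

  labelR-formed : (e : Exec remL remR) (j : ℕ) (r : Fin n) → FormedFrom j (labelR e j r)
  labelR-formed (done _) j r = tt
  labelR-formed {remR = remR} (step ℓ₁ _ _ _ e) j r with lookup (Nb remR ℓ₁) r
  ... | true  = ≤-refl
  ... | false = FormedFrom-weaken (labelR e (suc j) r) (labelR-formed e (suc j) r)

  labelR-separated : (e : Exec remL remR) {lab : Label} →
    lab ≡ clus k ⊎ lab ≡ singL ℓ → lab ≢ labelR e (suc k) r
  labelR-separated {k = k} {r = r} e (inj₁ refl) eq =
    n≮n k (subst (FormedFrom (suc k)) (sym eq) (labelR-formed e (suc k) r))
  labelR-separated {k = k} {r = r} e (inj₂ refl) eq =
    subst (FormedFrom (suc k)) (sym eq) (labelR-formed e (suc k) r)

  phaseTuple : Subset n → Fin m → Fin m → Tuple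
  phaseTuple remR ℓ₁ ℓ = tuple ℓ₁ ℓ (R₁ remR ℓ₁ ℓ) (R₁₂ remR ℓ₁ ℓ) (R₂ remR ℓ₁ ℓ)

  phaseTuple-valid : ℓ ≢ ℓ₁ → ValidTuple (phaseTuple remR ℓ₁ ℓ)
  phaseTuple-valid {ℓ} {ℓ₁} {remR} ℓ≢ℓ₁ =
    (λ eq → ℓ≢ℓ₁ (sym eq)) ,
    restrict-∖ (NG ℓ₁) (NG ℓ) remR ,
    restrict-∖ (NG ℓ) (NG ℓ₁) remR ,
    restrict-∩ (NG ℓ₁) (NG ℓ) remR

  data PhaseColours (remL : Subset m) (remR : Subset n) (ℓ₁ : Fin m) (c : Fin m → Bool)
                    (ℓ : Fin m) (r : Fin n) : Set where
    via-R₁  : r ∈ R₁ remR ℓ₁ ℓ → PhaseColours remL remR ℓ₁ c ℓ r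
    via-R₁₂ : r ∈ R₁₂ remR ℓ₁ ℓ → PhaseColours remL remR ℓ₁ c ℓ r
    via-R₂  : r ∈ R₂ remR ℓ₁ ℓ → processed remL ℓ₁ c ℓ ≡ true → PhaseColours remL remR ℓ₁ c ℓ r

  ColouredInPhase : Subset m → Subset n → Fin m → (Fin m → Bool) → Tuple → Fin m → Fin n → Set
  ColouredInPhase remL remR ℓ₁ c T ℓ r =
    XPhase remL remR ℓ₁ T × ℓ ≡ ℓ₂ᵀ T ×
    (r ∈ S₁ T ⊎ r ∈ S₁₂ T ⊎ (r ∈ S₂ T × processed remL ℓ₁ c (ℓ₂ᵀ T) ≡ true))

  inPhase-characterised : ∀ {T} (c : Fin m → Bool) → ColouredInPhase remL remR ℓ₁ c T ℓ r →
    T ≡ phaseTuple remR ℓ₁ ℓ × ℓ ∈ remL × PhaseColours remL remR ℓ₁ c ℓ r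
  inPhase-characterised {T = tuple _ _ _ _ _} c ((refl , ℓ∈ , refl , refl , refl) , refl , which) =
    refl , ℓ∈ , colours which
    where
      colours : _ → PhaseColours _ _ _ c _ _
      colours (inj₁ r∈)                     = via-R₁ r∈
      colours (inj₂ (inj₁ r∈))              = via-R₁₂ r∈
      colours (inj₂ (inj₂ (r∈ , processed))) = via-R₂ r∈ processed

  inPhase-intro : ℓ ∈ remL → PhaseColours remL remR ℓ₁ c ℓ r →
    ColouredInPhase remL remR ℓ₁ c (phaseTuple remR ℓ₁ ℓ) ℓ r
  inPhase-intro ℓ∈ (via-R₁ r∈)            = (refl , ℓ∈ , refl , refl , refl) , refl , inj₁ r∈
  inPhase-intro ℓ∈ (via-R₁₂ r∈)           = (refl , ℓ∈ , refl , refl , refl) , refl , inj₂ (inj₁ r∈)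
  inPhase-intro ℓ∈ (via-R₂ r∈ processed) =
    (refl , ℓ∈ , refl , refl , refl) , refl , inj₂ (inj₂ (r∈ , processed))

  PhaseColours-live : PhaseColours remL remR ℓ₁ c ℓ r → r ∈ remR
  PhaseColours-live {remR = remR} {ℓ₁} (via-R₁ r∈) =
    p∩q⊆q (NG ℓ₁) remR (p∩q⊆p (Nb remR ℓ₁) _ r∈)
  PhaseColours-live {remR = remR} {ℓ₁} (via-R₁₂ r∈) =
    p∩q⊆q (NG ℓ₁) remR (p∩q⊆p (Nb remR ℓ₁) _ r∈)
  PhaseColours-live {remR = remR} {ℓ = ℓ} (via-R₂ r∈ _) =
    p∩q⊆q (NG ℓ) remR (p∩q⊆p (Nb remR ℓ) _ r∈)

  PhaseColours-removes : PhaseColours remL remR ℓ₁ c ℓ r →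
    ℓ ∈ newL remL ℓ₁ c → r ∈ newR remR ℓ₁ → ⊥
  PhaseColours-removes {remR = remR} {ℓ₁} (via-R₁ r∈) _ r∈new =
    proj₂ (∖-elim r∈new) (p∩q⊆p (Nb remR ℓ₁) _ r∈)
  PhaseColours-removes {remR = remR} {ℓ₁} (via-R₁₂ r∈) _ r∈new =
    proj₂ (∖-elim r∈new) (p∩q⊆p (Nb remR ℓ₁) _ r∈)
  PhaseColours-removes {remL} {ℓ₁ = ℓ₁} {c} (via-R₂ _ processed≡true) ℓ∈new _
    with trans (sym processed≡true) (newL-unprocessed remL ℓ₁ c ℓ∈new)
  ... | ()

  coloured-alive : ∀ {T} (e : Exec remL remR) → ColoredBy e T ℓ r → ℓ ∈ remL × r ∈ remR
  coloured-alive (step ℓ₁ _ c _ e) (inj₁ here) with inPhase-characterised c here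
  ... | _ , ℓ∈ , colours = ℓ∈ , PhaseColours-live colours
  coloured-alive (step ℓ₁ _ c _ e) (inj₂ later) =
    map× newL-alive (λ r∈ → proj₁ (∖-elim r∈)) (coloured-alive e later)

  inPhase-then-later : ∀ {T T′} (e : Exec (newL remL ℓ₁ c) (newR remR ℓ₁)) →
    ColouredInPhase remL remR ℓ₁ c T ℓ r → ColoredBy e T′ ℓ r → ⊥
  inPhase-then-later {c = c} e here later with inPhase-characterised c here | coloured-alive e later
  ... | _ , _ , colours | ℓ∈new , r∈new = PhaseColours-removes colours ℓ∈new r∈new

  colouring-unique : ∀ {T T′} (e : Exec remL remR) → ColoredBy e T ℓ r → ColoredBy e T′ ℓ r → T ≡ T′
  colouring-unique (step ℓ₁ _ c _ e) (inj₁ here) (inj₁ here′) =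
    trans (proj₁ (inPhase-characterised c here)) (sym (proj₁ (inPhase-characterised c here′)))
  colouring-unique (step ℓ₁ _ c _ e) (inj₁ here) (inj₂ later′) =
    ⊥-elim (inPhase-then-later e here later′)
  colouring-unique (step ℓ₁ _ c _ e) (inj₂ later) (inj₁ here′) =
    ⊥-elim (inPhase-then-later e here′ later)
  colouring-unique (step ℓ₁ _ c _ e) (inj₂ later) (inj₂ later′) = colouring-unique e later later′

  Coloured : Exec remL remR → Fin m → Fin n → Set
  Coloured e ℓ r = Σ Tuple (λ T → ValidTuple T × ColoredBy e T ℓ r)

  module PhaseColouring (ℓ₁ : Fin m) (p : ℓ₁ ∈ remL) (c : Fin m → Bool)
                        (v : ValidCoins remL remR ℓ₁ c) (e : Exec (newL remL ℓ₁ c) (newR remR ℓ₁)) where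
    open PhaseLabels ℓ₁ p c v e

    coloured-now : ℓ ∈ remL → ℓ ≢ ℓ₁ → PhaseColours remL remR ℓ₁ c ℓ r →
      Coloured (step ℓ₁ p c v e) ℓ r
    coloured-now ℓ∈ ℓ≢ℓ₁ colours =
      phaseTuple _ ℓ₁ _ , phaseTuple-valid ℓ≢ℓ₁ , inj₁ (inPhase-intro ℓ∈ colours)

    centre-consistent : r ∈ remR →
      ¬ Mismatch (E ℓ₁ r) (labelL (step ℓ₁ p c v e) k ℓ₁) (labelR (step ℓ₁ p c v e) k r)
    centre-consistent {r = r} {k = k} r∈ with E ℓ₁ r in edge
    ... | true  = edge-together refl
      (trans (labelL-centre {k = k}) (sym (labelR-taken (Nb-member r∈ edge))))
    ... | false = non-edge-apart refl (λ eq →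
      labelR-separated {ℓ = ℓ₁} e (inj₁ (labelL-centre {k = k}))
        (trans eq (labelR-deferred (Nb-nonmember edge))))

    coloured-taken : ℓ ∈ remL → r ∈ remR → ℓ ≢ ℓ₁ → E ℓ₁ r ≡ true → Coloured (step ℓ₁ p c v e) ℓ r
    coloured-taken {ℓ} {r} ℓ∈ r∈ ℓ≢ℓ₁ edge₁ with E ℓ r in edge
    ... | false = coloured-now ℓ∈ ℓ≢ℓ₁ (via-R₁ (∖-member (Nb-member r∈ edge₁) (Nb-nonmember edge)))
    ... | true  = coloured-now ℓ∈ ℓ≢ℓ₁ (via-R₁₂ (x∈p∩q⁺ (Nb-member r∈ edge₁ , Nb-member r∈ edge)))

    coloured-processed : ℓ ∈ remL → r ∈ remR → ℓ ≢ ℓ₁ → E ℓ₁ r ≡ false →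
      processed remL ℓ₁ c ℓ ≡ true →
      Mismatch (E ℓ r) (labelL (step ℓ₁ p c v e) k ℓ) (labelR (step ℓ₁ p c v e) k r) →
      Coloured (step ℓ₁ p c v e) ℓ r
    coloured-processed {ℓ} {r} ℓ∈ r∈ ℓ≢ℓ₁ no-edge₁ processed≡true mismatch with E ℓ r in edge
    ... | true  = coloured-now ℓ∈ ℓ≢ℓ₁
      (via-R₂ (∖-member (Nb-member r∈ edge) (Nb-nonmember no-edge₁)) processed≡true)
    ... | false = ⊥-elim (non-edge-apart refl (λ eq →
      labelR-separated e (labelL-processed ℓ≢ℓ₁ processed≡true)
        (trans eq (labelR-deferred (Nb-nonmember no-edge₁)))) mismatch)

  coloured-if-mismatch : (e : Exec remL remR) (k : ℕ) (ℓ : Fin m) (r : Fin n) →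
    ℓ ∈ remL → r ∈ remR → Mismatch (E ℓ r) (labelL e k ℓ) (labelR e k r) → Coloured e ℓ r
  coloured-if-mismatch (done empty) k ℓ r ℓ∈ _ _ = ⊥-elim (empty ℓ ℓ∈)
  coloured-if-mismatch {remL = remL} (step ℓ₁ p c v e) k ℓ r ℓ∈ r∈ mismatch = case ℓ ≟ ℓ₁ of λ
    { (yes refl) → ⊥-elim (centre-consistent r∈ mismatch)
    ; (no ℓ≢ℓ₁)  → non-centre ℓ≢ℓ₁
    }
    where
      open PhaseLabels ℓ₁ p c v e
      open PhaseColouring ℓ₁ p c v e

      non-centre : ℓ ≢ ℓ₁ → Coloured (step ℓ₁ p c v e) ℓ r
      non-centre ℓ≢ℓ₁ with E ℓ₁ r in edge₁ | processed remL ℓ₁ c ℓ ≟ᵇ true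
      ... | true  | _                  = coloured-taken ℓ∈ r∈ ℓ≢ℓ₁ edge₁
      ... | false | yes processed≡true = coloured-processed ℓ∈ r∈ ℓ≢ℓ₁ edge₁ processed≡true mismatch
      ... | false | no processed≢true
        with coloured-if-mismatch e (suc k) ℓ r
               (newL-member ℓ∈ ℓ≢ℓ₁ (¬-not processed≢true)) (∖-member r∈ (Nb-nonmember edge₁))
               (subst₂ (Mismatch (E ℓ r)) (labelL-unprocessed ℓ≢ℓ₁ (¬-not processed≢true))
                                          (labelR-deferred (Nb-nonmember edge₁)) mismatch)
      ...   | T , valid , later = T , valid , inj₂ later

open PivotBiCluster using (Exec; Tuple; ValidTuple; ColoredBy; Erroneous)

lemma1 : ∀ {m n : ℕ} (E : Fin m → Fin n → Bool) (e : Exec E ⊤ ⊤) →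
    (∀ (ℓ : Fin m) (r : Fin n) (T T′ : Tuple E) →
    ValidTuple E T → ValidTuple E T′ →
    ColoredBy E e T ℓ r → ColoredBy E e T′ ℓ r → T ≡ T′)
    × (∀ (ℓ : Fin m) (r : Fin n) → Erroneous E e ℓ r →
    Σ (Tuple E) (λ T → ValidTuple E T × ColoredBy E e T ℓ r))
lemma1 E e =
  (λ ℓ r T T′ _ _ → colouring-unique e) ,
  (λ ℓ r → coloured-if-mismatch e 0 ℓ r ∈⊤ ∈⊤)
  where open Analysis E
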